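{- Let $\mathbf{t}$ be the Tribonacci word. If $w$ is a nonempty palindromic prefix of $\mathbf{t}$, then the letters immediately following the first occurrence and the second occurrence of $w$ in $\mathbf{t}$ are different.
   Context: The Tribonacci word is $\mathbf{t}=\sigma^{\omega}(0)=0102010010201\cdots$, the fixed point of $\sigma(0)=01$, $\sigma(1)=02$, $\sigma(2)=0$. A palindrome is a word equal to its reversal. -}

module Defs where

open import Data.Nat using (ℕ; zero; suc; _+_; _<_)
open import Data.Fin using (Fin; zero; suc)
open import Data.List using (List; []; _∷_; _++_; concatMap; reverse; length; map; upTo)
open import Data.Product using (Σ; _×_)
open import Relation.Binary.PropositionalEquality using (_≡_)

Letter : Set
Letter = Fin 3

σ : Letter → List Letter
σ zero = zero ∷ suc zero ∷ []
σ (suc zero) = zero ∷ suc (suc zero) ∷ []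
σ (suc (suc zero)) = zero ∷ []

σ* : List Letter → List Letter
σ* = concatMap σ

σⁿ0 : ℕ → List Letter
σⁿ0 zero = zero ∷ []
σⁿ0 (suc n) = σ* (σⁿ0 n)

-- i-th letter of a list, with a default (never used below, see tribonacci)
nth : List Letter → ℕ → Letter
nth [] _ = zero
nth (x ∷ xs) zero = x
nth (x ∷ xs) (suc i) = nth xs i

-- The Tribonacci word t = σ^ω(0), as a function ℕ → Letter.
-- σ^n(0) is a prefix of σ^{n+1}(0) and |σ^n(0)| ≥ n+1, so letter i of t
-- is letter i of σ^{i}(0) (the default in nth is never reached).
t : ℕ → Letter
t i = nth (σⁿ0 i) i

factor : ℕ → ℕ → List Letter
factor i n = map (λ j → t (i + j)) (upTo n)

prefix : ℕ → List Letter
prefix n = factor 0 n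

Palindrome : List Letter → Set
Palindrome w = reverse w ≡ w

OccursAt : List Letter → ℕ → Set
OccursAt w i = factor i (length w) ≡ w

SecondOccurrence : List Letter → ℕ → Set
SecondOccurrence w i = (0 < i) × OccursAt w i × (∀ k → 0 < k → k < i → OccursAt w k → Data.Empty.⊥)
  where import Data.Empty

module Submission where

-- Write t as the concatenation of its blocks σ(t 0) σ(t 1) σ(t 2) …, the
-- j-th block starting at position p j.  Every block begins with 0 and the
-- letter after the 0 starting block j is rot (t j), where rot is the cyclic
-- shift 0 ↦ 1 ↦ 2 ↦ 0; conversely every 0 of t starts a block.  The map
-- φ(u) = σ(u)0 therefore acts on occurrences: u occurs at j iff φ(u)
-- occurs at p j, and the letter after that occurrence of φ(u) is the rot of
-- the letter after u.
--
-- It follows that the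
-- nonempty palindromic prefixes of t are exactly φ¹(ε), φ²(ε), …, and that
-- "the second occurrence is followed by a different letter than the first"
-- passes from u to φ(u), with base case φ(ε) = 0.  The theorem combines both.

open import Defs
open import Data.Nat using (ℕ; zero; suc; _+_; _∸_; _<_; _≤_; z≤n; s≤s)
open import Data.Nat.Properties
  using ( +-suc; +-assoc; +-comm; +-identityʳ; +-mono-≤; m<m+n; m∸n+n≡m; ≤-refl; ≤-trans; ≤-pred
        ; <⇒≤; <-≤-trans; <⇒≱; ≮⇒≥; _<?_; ≤-total; module ≤-Reasoning)
open import Data.Fin using (zero; suc)
open import Data.List using (List; []; _∷_; _++_; length; reverse; map; applyUpTo)
open import Data.List.Properties
  using (concatMap-++; length-++; ++-assoc; ++-identityʳ; ∷-injective; map-applyUpTo; map-upTo; reverse-++; unfold-reverse)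
open import Data.Product using (Σ; _×_; _,_; proj₁; proj₂)
open import Data.Sum using (_⊎_; inj₁; inj₂)
open import Data.Empty using (⊥-elim)
open import Data.Unit using (⊤; tt)
open import Relation.Nullary using (¬_; yes; no; contradiction)
open import Relation.Binary.PropositionalEquality
  using (_≡_; _≢_; refl; sym; trans; cong; cong₂; subst; module ≡-Reasoning)

pattern 𝟘 = zero
pattern 𝟙 = suc zero
pattern 𝟚 = suc (suc zero)

-- Occurrences of words in t

Occ : List Letter → ℕ → Set
Occ []      i = ⊤
Occ (x ∷ w) i = t i ≡ x × Occ w (suc i)

Occ-++⁻ : ∀ u v i → Occ (u ++ v) i → Occ u i × Occ v (i + length u)
Occ-++⁻ []      v i o       = tt , subst (Occ v) (sym (+-identityʳ i)) o
Occ-++⁻ (x ∷ u) v i (e , o) with Occ-++⁻ u v (suc i) o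
... | ou , ov = (e , ou) , subst (Occ v) (sym (+-suc i (length u))) ov

Occ-++⁺ : ∀ u v i → Occ u i → Occ v (i + length u) → Occ (u ++ v) i
Occ-++⁺ []      v i _        ov = subst (Occ v) (+-identityʳ i) ov
Occ-++⁺ (x ∷ u) v i (e , ou) ov = e , Occ-++⁺ u v (suc i) ou (subst (Occ v) (+-suc i (length u)) ov)

applyUpTo-cong : ∀ {g h : ℕ → Letter} n → (∀ k → g k ≡ h k) → applyUpTo g n ≡ applyUpTo h n
applyUpTo-cong zero    g≗h = refl
applyUpTo-cong (suc n) g≗h = cong₂ _∷_ (g≗h 0) (applyUpTo-cong n (λ k → g≗h (suc k)))

factor-suc : ∀ i n → factor i (suc n) ≡ t i ∷ factor (suc i) n
factor-suc i n = cong₂ _∷_ (cong t (+-identityʳ i)) (begin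
    map (λ j → t (i + j)) (applyUpTo suc n)     ≡⟨ map-applyUpTo suc (λ j → t (i + j)) n ⟩
    applyUpTo (λ j → t (i + suc j)) n           ≡⟨ applyUpTo-cong n (λ j → cong t (+-suc i j)) ⟩
    applyUpTo (λ j → t (suc i + j)) n           ≡⟨ sym (map-upTo (λ j → t (suc i + j)) n) ⟩
    factor (suc i) n                            ∎)
  where open ≡-Reasoning

occursAt⇒Occ : ∀ w i → OccursAt w i → Occ w i
occursAt⇒Occ []      i _ = tt
occursAt⇒Occ (x ∷ w) i e with ∷-injective (trans (sym (factor-suc i (length w))) e)
... | ti≡x , rest = ti≡x , occursAt⇒Occ w (suc i) rest

Occ⇒occursAt : ∀ w i → Occ w i → OccursAt w i
Occ⇒occursAt []      i _         = refl
Occ⇒occursAt (x ∷ w) i (ti≡x , o) =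
  trans (factor-suc i (length w)) (cong₂ _∷_ ti≡x (Occ⇒occursAt w (suc i) o))

-- The approximations σⁿ(0) are prefixes of t

nth-++ˡ : ∀ xs ys i → i < length xs → nth (xs ++ ys) i ≡ nth xs i
nth-++ˡ (x ∷ xs) ys zero    _         = refl
nth-++ˡ (x ∷ xs) ys (suc i) (s≤s i<n) = nth-++ˡ xs ys i i<n

σ-nonempty : ∀ a → 0 < length (σ a)
σ-nonempty 𝟘 = s≤s z≤n
σ-nonempty 𝟙 = s≤s z≤n
σ-nonempty 𝟚 = s≤s z≤n

σ*-nonempty : ∀ a r → 0 < length (σ* (a ∷ r))
σ*-nonempty 𝟘 r = s≤s z≤n
σ*-nonempty 𝟙 r = s≤s z≤n
σ*-nonempty 𝟚 r = s≤s z≤n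

σⁿ0-extends : ∀ n → Σ (List Letter) λ r → σⁿ0 (suc n) ≡ σⁿ0 n ++ r × 0 < length r
σⁿ0-extends zero = 𝟙 ∷ [] , refl , s≤s z≤n
σⁿ0-extends (suc n) with σⁿ0-extends n
... | []    , _ , ()
... | a ∷ r , e , _ = σ* (a ∷ r) , trans (cong σ* e) (concatMap-++ σ (σⁿ0 n) (a ∷ r)) , σ*-nonempty a r

σⁿ0-grows : ∀ m d → Σ (List Letter) λ r → σⁿ0 (d + m) ≡ σⁿ0 m ++ r
σⁿ0-grows m zero = [] , sym (++-identityʳ (σⁿ0 m))
σⁿ0-grows m (suc d) with σⁿ0-grows m d | σⁿ0-extends (d + m)
... | r , e | r′ , e′ , _ = r ++ r′ , trans e′ (trans (cong (_++ r′) e) (++-assoc (σⁿ0 m) r r′))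

-- σⁿ(0) has more than n letters, so letter n of t is read inside σⁿ(0).
σⁿ0-long : ∀ n → n < length (σⁿ0 n)
σⁿ0-long zero = s≤s z≤n
σⁿ0-long (suc n) with σⁿ0-extends n
... | r , e , r-nonempty = begin
    suc (suc n)                    ≤⟨ +-mono-≤ r-nonempty (σⁿ0-long n) ⟩
    length r + length (σⁿ0 n)      ≡⟨ +-comm (length r) _ ⟩
    length (σⁿ0 n) + length r      ≡⟨ sym (length-++ (σⁿ0 n)) ⟩
    length (σⁿ0 n ++ r)            ≡⟨ cong length (sym e) ⟩
    length (σⁿ0 (suc n))           ∎
  where open ≤-Reasoning

σⁿ0-stable : ∀ {m n} i → m ≤ n → i < length (σⁿ0 m) → nth (σⁿ0 n) i ≡ nth (σⁿ0 m) i
σⁿ0-stable {m} {n} i m≤n i<m with σⁿ0-grows m (n ∸ m)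
... | r , e = begin
    nth (σⁿ0 n) i               ≡⟨ cong (λ k → nth (σⁿ0 k) i) (sym (m∸n+n≡m m≤n)) ⟩
    nth (σⁿ0 (n ∸ m + m)) i     ≡⟨ cong (λ w → nth w i) e ⟩
    nth (σⁿ0 m ++ r) i          ≡⟨ nth-++ˡ (σⁿ0 m) r i i<m ⟩
    nth (σⁿ0 m) i               ∎
  where open ≡-Reasoning

t-σⁿ0 : ∀ n i → i < length (σⁿ0 n) → t i ≡ nth (σⁿ0 n) i
t-σⁿ0 n i i<n with ≤-total i n
... | inj₁ i≤n = sym (σⁿ0-stable i i≤n (σⁿ0-long i))
... | inj₂ n≤i = σⁿ0-stable i n≤i i<n

Occ-from-nth : ∀ w k → (∀ i → i < length w → t (k + i) ≡ nth w i) → Occ w k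
Occ-from-nth []      k _ = tt
Occ-from-nth (x ∷ w) k h =
    trans (cong t (sym (+-identityʳ k))) (h 0 (s≤s z≤n))
  , Occ-from-nth w (suc k) (λ i i<w → trans (cong t (sym (+-suc k i))) (h (suc i) (s≤s i<w)))

σⁿ0-prefix : ∀ n → Occ (σⁿ0 n) 0
σⁿ0-prefix n = Occ-from-nth (σⁿ0 n) 0 (t-σⁿ0 n)

-- The block decomposition t = σ(t 0) σ(t 1) σ(t 2) …

p : ℕ → ℕ
p zero    = 0
p (suc j) = p j + length (σ (t j))

p-step : ∀ j {a} → t j ≡ a → p (suc j) ≡ length (σ a) + p j
p-step j {a} tj≡a = trans (cong (λ b → p j + length (σ b)) tj≡a) (+-comm (p j) (length (σ a)))

blocks-of : ∀ u k → Occ u k → Occ (σ* u) (p k) → ∀ i → i < length u → Occ (σ (t (k + i))) (p (k + i))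
blocks-of (x ∷ u) k (refl , o) oσ zero _ =
  subst (λ m → Occ (σ (t m)) (p m)) (sym (+-identityʳ k)) (proj₁ (Occ-++⁻ (σ (t k)) (σ* u) (p k) oσ))
blocks-of (x ∷ u) k (refl , o) oσ (suc i) (s≤s i<u) =
  subst (λ m → Occ (σ (t m)) (p m)) (sym (+-suc k i))
    (blocks-of u (suc k) o (proj₂ (Occ-++⁻ (σ (t k)) (σ* u) (p k) oσ)) i i<u)

-- t is the fixed point of σ: the j-th block σ(t j) occurs at p j.
block-occurs : ∀ j → Occ (σ (t j)) (p j)
block-occurs j = blocks-of (σⁿ0 j) 0 (σⁿ0-prefix j) (σⁿ0-prefix (suc j)) j (σⁿ0-long j)

-- The cyclic shift 0 ↦ 1 ↦ 2 ↦ 0: the letter following the initial 0 of σ(a)0.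
rot : Letter → Letter
rot 𝟘 = 𝟙
rot 𝟙 = 𝟚
rot 𝟚 = 𝟘

rot⁻¹ : Letter → Letter
rot⁻¹ 𝟘 = 𝟚
rot⁻¹ 𝟙 = 𝟘
rot⁻¹ 𝟚 = 𝟙

rot⁻¹-rot : ∀ a → rot⁻¹ (rot a) ≡ a
rot⁻¹-rot 𝟘 = refl
rot⁻¹-rot 𝟙 = refl
rot⁻¹-rot 𝟚 = refl

rot-injective : ∀ {a b} → rot a ≡ rot b → a ≡ b
rot-injective {a} {b} e = trans (sym (rot⁻¹-rot a)) (trans (cong rot⁻¹ e) (rot⁻¹-rot b))

rot≡𝟘 : ∀ {a} → rot a ≡ 𝟘 → a ≡ 𝟚
rot≡𝟘 {a} e = trans (sym (rot⁻¹-rot a)) (cong rot⁻¹ e)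

σ-starts-with-𝟘 : ∀ a {i} → Occ (σ a) i → t i ≡ 𝟘
σ-starts-with-𝟘 𝟘 = proj₁
σ-starts-with-𝟘 𝟙 = proj₁
σ-starts-with-𝟘 𝟚 = proj₁

t-at-block : ∀ j → t (p j) ≡ 𝟘
t-at-block j = σ-starts-with-𝟘 (t j) (block-occurs j)

-- The letter after the start of block j is rot (t j); for t j = 2 it starts block j+1.
t-after-block : ∀ j {a} → t j ≡ a → t (suc (p j)) ≡ rot a
t-after-block j {𝟘} tj≡a = proj₁ (proj₂ (subst (λ b → Occ (σ b) (p j)) tj≡a (block-occurs j)))
t-after-block j {𝟙} tj≡a = proj₁ (proj₂ (subst (λ b → Occ (σ b) (p j)) tj≡a (block-occurs j)))
t-after-block j {𝟚} tj≡a = subst (λ m → t m ≡ 𝟘) (p-step j tj≡a) (t-at-block (suc j))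

two-letter-block : ∀ j → t j ≢ 𝟚 → p (suc j) ≡ suc (suc (p j))
two-letter-block j tj≢𝟚 with t j in eq
... | 𝟘 = +-comm (p j) 2
... | 𝟙 = +-comm (p j) 2
... | 𝟚 = ⊥-elim (tj≢𝟚 refl)

in-block : ∀ i → Σ ℕ λ j → (p j ≡ i) ⊎ (suc (p j) ≡ i × t j ≢ 𝟚)
in-block zero = 0 , inj₁ refl
in-block (suc i) with in-block i
... | j , inj₂ (refl , tj≢𝟚) = suc j , inj₁ (two-letter-block j tj≢𝟚)
... | j , inj₁ refl with t j in eq
...   | 𝟘 = j , inj₂ (refl , λ e → contradiction (trans (sym eq) e) λ ())
...   | 𝟙 = j , inj₂ (refl , λ e → contradiction (trans (sym eq) e) λ ())
...   | 𝟚 = suc j , inj₁ (p-step j eq)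

𝟘-starts-block : ∀ i → t i ≡ 𝟘 → Σ ℕ λ j → p j ≡ i
𝟘-starts-block i ti≡𝟘 with in-block i
... | j , inj₁ pj≡i = j , pj≡i
... | j , inj₂ (refl , tj≢𝟚) = ⊥-elim (tj≢𝟚 (rot≡𝟘 (trans (sym (t-after-block j refl)) ti≡𝟘)))

p-increasing : ∀ j → p j < p (suc j)
p-increasing j = m<m+n (p j) (σ-nonempty (t j))

p-monotone : ∀ {j k} → j ≤ k → p j ≤ p k
p-monotone {j} {k} j≤k = subst (λ n → p j ≤ p n) (m∸n+n≡m j≤k) (shift (k ∸ j))
  where
  shift : ∀ d → p j ≤ p (d + j)
  shift zero    = ≤-refl
  shift (suc d) = ≤-trans (shift d) (<⇒≤ (p-increasing (d + j)))

p-strict : ∀ {j k} → j < k → p j < p k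
p-strict {j} j<k = <-≤-trans (p-increasing j) (p-monotone j<k)

p-reflects : ∀ {j k} → p j < p k → j < k
p-reflects {j} {k} pj<pk with j <? k
... | yes j<k = j<k
... | no  j≮k = contradiction (p-monotone (≮⇒≥ j≮k)) (<⇒≱ pj<pk)

-- The map φ(u) = σ(u)0

φ : List Letter → List Letter
φ []      = 𝟘 ∷ []
φ (a ∷ u) = σ a ++ φ u

φ≡σ*0 : ∀ u → φ u ≡ σ* u ++ 𝟘 ∷ []
φ≡σ*0 []      = refl
φ≡σ*0 (a ∷ u) = trans (cong (σ a ++_) (φ≡σ*0 u)) (sym (++-assoc (σ a) (σ* u) _))

-- φ strictly lengthens words (used as the termination measure for decoding).
φ-longer : ∀ u → length u < length (φ u)
φ-longer []      = s≤s z≤n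
φ-longer (a ∷ u) = subst (suc (length u) <_) (sym (length-++ (σ a)))
                     (+-mono-≤ (σ-nonempty a) (φ-longer u))

φ⁻¹ : List Letter → List Letter
φ⁻¹ (𝟘 ∷ 𝟙 ∷ r)       = 𝟘 ∷ φ⁻¹ r
φ⁻¹ (𝟘 ∷ 𝟚 ∷ r)       = 𝟙 ∷ φ⁻¹ r
φ⁻¹ (𝟘 ∷ r@(𝟘 ∷ _))   = 𝟚 ∷ φ⁻¹ r
φ⁻¹ _                 = []

-- φ(u) always begins with 0, so a leading 0 in front of it is decoded as the letter 2.
φ⁻¹-𝟘φ : ∀ u → φ⁻¹ (𝟘 ∷ φ u) ≡ 𝟚 ∷ φ⁻¹ (φ u)
φ⁻¹-𝟘φ []      = refl
φ⁻¹-𝟘φ (𝟘 ∷ u) = refl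
φ⁻¹-𝟘φ (𝟙 ∷ u) = refl
φ⁻¹-𝟘φ (𝟚 ∷ u) = refl

φ⁻¹-φ : ∀ u → φ⁻¹ (φ u) ≡ u
φ⁻¹-φ []      = refl
φ⁻¹-φ (𝟘 ∷ u) = cong (𝟘 ∷_) (φ⁻¹-φ u)
φ⁻¹-φ (𝟙 ∷ u) = cong (𝟙 ∷_) (φ⁻¹-φ u)
φ⁻¹-φ (𝟚 ∷ u) = trans (φ⁻¹-𝟘φ u) (cong (𝟚 ∷_) (φ⁻¹-φ u))

φ-injective : ∀ {u v} → φ u ≡ φ v → u ≡ v
φ-injective {u} {v} e = trans (sym (φ⁻¹-φ u)) (trans (cong φ⁻¹ e) (φ⁻¹-φ v))

φ-∷ʳ : ∀ v a → φ (v ++ a ∷ []) ≡ φ v ++ reverse (σ a)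
φ-∷ʳ []      𝟘 = refl
φ-∷ʳ []      𝟙 = refl
φ-∷ʳ []      𝟚 = refl
φ-∷ʳ (b ∷ v) a = trans (cong (σ b ++_) (φ-∷ʳ v a)) (sym (++-assoc (σ b) (φ v) _))

-- φ commutes with reversal (σ(a)0 reversed is 0 followed by the reversal of σ(a)).
φ-reverse : ∀ u → φ (reverse u) ≡ reverse (φ u)
φ-reverse []      = refl
φ-reverse (a ∷ u) = begin
    φ (reverse (a ∷ u))                  ≡⟨ cong φ (unfold-reverse a u) ⟩
    φ (reverse u ++ a ∷ [])              ≡⟨ φ-∷ʳ (reverse u) a ⟩
    φ (reverse u) ++ reverse (σ a)       ≡⟨ cong (_++ reverse (σ a)) (φ-reverse u) ⟩
    reverse (φ u) ++ reverse (σ a)       ≡⟨ sym (reverse-++ (σ a) (φ u)) ⟩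
    reverse (σ a ++ φ u)                 ∎
  where open ≡-Reasoning

φ-occurs : ∀ u j → Occ u j → Occ (φ u) (p j)
φ-occurs []      j _          = t-at-block j , tt
φ-occurs (a ∷ u) j (refl , o) = Occ-++⁺ (σ (t j)) (φ u) (p j) (block-occurs j) (φ-occurs u (suc j) o)

φ-end : ∀ u j → Occ u j → p j + length (φ u) ≡ suc (p (j + length u))
φ-end []      j _          = trans (+-comm (p j) 1) (cong (λ k → suc (p k)) (sym (+-identityʳ j)))
φ-end (a ∷ u) j (refl , o) = begin
    p j + length (σ (t j) ++ φ u)                 ≡⟨ cong (p j +_) (length-++ (σ (t j))) ⟩
    p j + (length (σ (t j)) + length (φ u))       ≡⟨ sym (+-assoc (p j) _ _) ⟩
    p (suc j) + length (φ u)                      ≡⟨ φ-end u (suc j) o ⟩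
    suc (p (suc j + length u))                    ≡⟨ cong (λ k → suc (p k)) (sym (+-suc j (length u))) ⟩
    suc (p (j + suc (length u)))                  ∎
  where open ≡-Reasoning

φ-follower : ∀ u j → Occ u j → t (p j + length (φ u)) ≡ rot (t (j + length u))
φ-follower u j o = trans (cong t (φ-end u j o)) (t-after-block (j + length u) refl)

φ-starts-with-𝟘 : ∀ u {k} → Occ (φ u) k → t k ≡ 𝟘
φ-starts-with-𝟘 []      o = proj₁ o
φ-starts-with-𝟘 (a ∷ u) {k} o = σ-starts-with-𝟘 a (proj₁ (Occ-++⁻ (σ a) (φ u) k o))

decode : ∀ v j → Occ (v ++ 𝟘 ∷ []) (p j) → Σ (List Letter) λ u → φ u ≡ v ++ 𝟘 ∷ [] × Occ u j
decode []      j _ = [] , refl , tt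
decode (x ∷ v) j (ex , o) with t j in eq
decode (x ∷ v) j (ex , o) | 𝟚 with decode v (suc j) (subst (Occ (v ++ 𝟘 ∷ [])) (sym (p-step j eq)) o)
... | u , e , ou = 𝟚 ∷ u , cong₂ _∷_ (trans (sym (t-at-block j)) ex) e , eq , ou
decode (x ∷ []) j (ex , (e𝟘 , _)) | 𝟘 = contradiction (trans (sym (t-after-block j eq)) e𝟘) λ ()
decode (x ∷ []) j (ex , (e𝟘 , _)) | 𝟙 = contradiction (trans (sym (t-after-block j eq)) e𝟘) λ ()
decode (x ∷ y ∷ v) j (ex , (ey , o)) | 𝟘 with decode v (suc j) (subst (Occ (v ++ 𝟘 ∷ [])) (sym (p-step j eq)) o)
... | u , e , ou = 𝟘 ∷ u , cong₂ _∷_ (trans (sym (t-at-block j)) ex)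
                                   (cong₂ _∷_ (trans (sym (t-after-block j eq)) ey) e) , eq , ou
decode (x ∷ y ∷ v) j (ex , (ey , o)) | 𝟙 with decode v (suc j) (subst (Occ (v ++ 𝟘 ∷ [])) (sym (p-step j eq)) o)
... | u , e , ou = 𝟙 ∷ u , cong₂ _∷_ (trans (sym (t-at-block j)) ex)
                                   (cong₂ _∷_ (trans (sym (t-after-block j eq)) ey) e) , eq , ou

desubstitute : ∀ u j → Occ (φ u) (p j) → Occ u j
desubstitute u j o with decode (σ* u) j (subst (λ w → Occ w (p j)) (φ≡σ*0 u) o)
... | u′ , e , ou′ = subst (λ w → Occ w j) (φ-injective (trans e (sym (φ≡σ*0 u)))) ou′

-- Nonempty palindromic prefixes are the iterates φⁿ(ε), n ≥ 1

φ^ : ℕ → List Letter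
φ^ zero    = []
φ^ (suc n) = φ (φ^ n)

-- They are prefixes of t, since φ maps occurrences at 0 to occurrences at p 0 = 0.
φ^-prefix : ∀ n → Occ (φ^ n) 0
φ^-prefix zero    = tt
φ^-prefix (suc n) = φ-occurs (φ^ n) 0 (φ^-prefix n)

palindromic-prefix-ends : ∀ x w → Occ (x ∷ w) 0 → reverse (x ∷ w) ≡ x ∷ w → reverse w ++ 𝟘 ∷ [] ≡ x ∷ w
palindromic-prefix-ends x w (t0≡x , _) pal =
  trans (cong (λ y → reverse w ++ y ∷ []) t0≡x) (trans (sym (unfold-reverse x w)) pal)

palindromic-prefix-decode : ∀ x w → Occ (x ∷ w) 0 → reverse (x ∷ w) ≡ x ∷ w →
  Σ (List Letter) λ u → φ u ≡ x ∷ w × Occ u 0 × reverse u ≡ u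
palindromic-prefix-decode x w o pal
  with decode (reverse w) 0 (subst (λ v → Occ v 0) (sym (palindromic-prefix-ends x w o pal)) o)
... | u , φu≡ , ou = u , φu≡xw , ou , φ-injective (begin
    φ (reverse u)     ≡⟨ φ-reverse u ⟩
    reverse (φ u)     ≡⟨ cong reverse φu≡xw ⟩
    reverse (x ∷ w)   ≡⟨ pal ⟩
    x ∷ w             ≡⟨ sym φu≡xw ⟩
    φ u               ∎)
  where
  open ≡-Reasoning
  φu≡xw : φ u ≡ x ∷ w
  φu≡xw = trans φu≡ (palindromic-prefix-ends x w o pal)

-- Since φ(u) is longer than u, iterating the decoding reaches ε.
palindromic-prefix : ∀ n w → length w ≤ n → Occ w 0 → reverse w ≡ w → Σ ℕ λ m → w ≡ φ^ m
palindromic-prefix _       []      _           _ _   = 0 , refl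
palindromic-prefix (suc n) (x ∷ w) (s≤s |w|≤n) o pal with palindromic-prefix-decode x w o pal
... | u , φu≡xw , ou , u-pal
  with palindromic-prefix n u (≤-trans (≤-pred (subst (length u <_) (cong length φu≡xw) (φ-longer u))) |w|≤n) ou u-pal
...   | m , u≡φ^m = suc m , trans (sym φu≡xw) (cong φ u≡φ^m)

-- The second occurrence and its follower

SecondOcc : List Letter → ℕ → Set
SecondOcc w i = (0 < i) × Occ w i × (∀ k → 0 < k → k < i → ¬ Occ w k)

DistinctFollowers : List Letter → Set
DistinctFollowers w = Σ ℕ λ i → SecondOcc w i × t (length w) ≢ t (i + length w)

-- If u is a prefix with distinct followers, so is φ(u): its second
-- occurrence is at p i, where i is the second occurrence of u.
φ-distinct : ∀ u → Occ u 0 → DistinctFollowers u → DistinctFollowers (φ u)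
φ-distinct u o₀ (i , (0<i , oᵢ , none-before) , differ) =
  p i , (p-strict 0<i , φ-occurs u i oᵢ , none-before′) , differ′
  where
  none-before′ : ∀ k → 0 < k → k < p i → ¬ Occ (φ u) k
  none-before′ k 0<k k<pi oₖ with 𝟘-starts-block k (φ-starts-with-𝟘 u oₖ)
  ... | j , refl = none-before j (p-reflects 0<k) (p-reflects k<pi) (desubstitute u j oₖ)
  differ′ : t (length (φ u)) ≢ t (p i + length (φ u))
  differ′ same = differ (rot-injective (trans (sym (φ-follower u 0 o₀)) (trans same (φ-follower u i oᵢ))))

-- The single letter 0 occurs next at position 2, followed by 2 instead of 1.
𝟘-distinct : DistinctFollowers (𝟘 ∷ [])
𝟘-distinct = 2 , (s≤s z≤n , (refl , tt) , none-before) , λ ()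
  where
  none-before : ∀ k → 0 < k → k < 2 → ¬ Occ (𝟘 ∷ []) k
  none-before 1             _ _                   (() , _)
  none-before (suc (suc k)) _ (s≤s (s≤s ())) _

φ^-distinct : ∀ n → DistinctFollowers (φ^ (suc n))
φ^-distinct zero    = 𝟘-distinct
φ^-distinct (suc n) = φ-distinct (φ^ (suc n)) (φ^-prefix (suc n)) (φ^-distinct n)

distinct⇒statement : ∀ w → DistinctFollowers w →
  Σ ℕ (λ i → SecondOccurrence w i × (t (length w) ≢ t (i + length w)))
distinct⇒statement w (i , (0<i , oᵢ , none-before) , differ) =
  i , (0<i , Occ⇒occursAt w i oᵢ , λ k 0<k k<i oₖ → none-before k 0<k k<i (occursAt⇒Occ w k oₖ)) , differ

mainTheorem20 : (w : List Letter) → 0 < length w → w ≡ prefix (length w) → Palindrome w →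
    Σ ℕ (λ i → SecondOccurrence w i × (t (length w) ≢ t (i + length w)))
mainTheorem20 w 0<|w| w-prefix w-palindrome
  with palindromic-prefix (length w) w ≤-refl (occursAt⇒Occ w 0 (sym w-prefix)) w-palindrome
... | zero  , refl = contradiction 0<|w| λ ()
... | suc n , refl = distinct⇒statement (φ^ (suc n)) (φ^-distinct n)
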